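{- Let $\pi$ be a permutation of length $m$ and $\sigma$ a permutation of length $n$ that are disjoint, let $A\subseteq[m+n-1]$, and let $L=\mathrm{Comp}(A)$. Then the number of shuffles $\tau\in S(\pi,\sigma)$ with $\mathrm{Des}(\tau)\subseteq A$ is equal to the number of pairs $(J,K)$ where $J$ is a weak composition of $m$ and $K$ is a weak composition of $n$ such that $J$ is a refinement of $\mathrm{Comp}(\pi)$, $K$ is a refinement of $\mathrm{Comp}(\sigma)$, $J$ and $K$ have the same number of parts as $L$, and $J+K=L$.
   Context: A permutation of length $n$ is a sequence $\pi=\pi_1\cdots\pi_n$ of $n$ distinct positive integers. Two permutations are disjoint if they have no letters in common; for disjoint $\pi,\sigma$ of lengths $m,n$, $S(\pi,\sigma)$ is the set of permutations of length $m+n$ containing both $\pi$ and $\sigma$ as subsequences. The descent set of $\pi$ is $\mathrm{Des}(\pi)=\{i\in[n-1]:\pi_i>\pi_{i+1}\}$. For $A=\{a_1<\cdots<a_j\}\subseteq[N-1]$, $\mathrm{Comp}(A)=(a_1,a_2-a_1,\dots,a_j-a_{j-1},N-a_j)$, a composition of $N$; the descent composition of a permutation $\pi$ of length $N$ is $\mathrm{Comp}(\pi)=\mathrm{Comp}(\mathrm{Des}(\pi))$. A weak composition of $n$ is a finite sequence of nonnegative integers summing to $n$. For weak compositions $J=(J_1,\dots,J_k)$, $K=(K_1,\dots,K_k)$ with the same number of parts, $J+K=(J_1+K_1,\dots,J_k+K_k)$. The refinement order on weak compositions of $n$ is the partial order in which $M$ covers $L$ iff $M$ is obtained from $L$ by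 replacing two consecutive parts $L_i,L_{i+1}$ by $L_i+L_{i+1}$; $L$ is a refinement of $M$ if $L\le M$ in this order. -}

module Defs where

open import Data.Nat using (ℕ; zero; suc; _+_; _∸_; _<_; _<ᵇ_)
open import Data.Bool using (if_then_else_)
open import Data.List using (List; []; _∷_; _++_; map; length; zipWith)
open import Data.Nat.ListAction using (sum)
open import Data.List.Relation.Unary.All using (All)
open import Data.List.Relation.Unary.Unique.Propositional using (Unique)
open import Data.List.Membership.Propositional using (_∈_; _∉_)
open import Data.List.Relation.Binary.Sublist.Propositional using (_⊆_)
open import Data.Product using (Σ; ∃-syntax; _×_; _,_)
open import Function.Bundles using (_⇔_)
open import Relation.Binary.PropositionalEquality using (_≡_)
open import Relation.Binary.Construct.Closure.ReflexiveTransitive using (Star)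

IsPerm : List ℕ → Set
IsPerm π = Unique π × All (λ x → 0 < x) π

Disjoint : List ℕ → List ℕ → Set
Disjoint π σ = ∀ x → x ∈ π → x ∉ σ

InS : List ℕ → List ℕ → List ℕ → Set
InS π σ τ = IsPerm τ × (length τ ≡ length π + length σ) × (π ⊆ τ) × (σ ⊆ τ)

-- Descent set, as the increasing list of (1-indexed) positions i with τ_i > τ_{i+1}.
Des : List ℕ → List ℕ
Des [] = []
Des (x ∷ []) = []
Des (x ∷ y ∷ r) = (if y <ᵇ x then 1 ∷ [] else []) ++ map suc (Des (y ∷ r))

-- Comp(A) for A = {a₁ < ⋯ < a_j} ⊆ [N-1]: (a₁, a₂-a₁, …, N-a_j).
compAux : ℕ → ℕ → List ℕ → List ℕ
compAux N prev [] = (N ∸ prev) ∷ []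
compAux N prev (a ∷ as) = (a ∸ prev) ∷ compAux N a as

Comp : ℕ → List ℕ → List ℕ
Comp N A = compAux N 0 A

CompPerm : List ℕ → List ℕ
CompPerm π = Comp (length π) (Des π)

WeakComp : ℕ → List ℕ → Set
WeakComp n J = sum J ≡ n

Covers : List ℕ → List ℕ → Set
Covers L M = ∃[ pre ] ∃[ a ] ∃[ b ] ∃[ suf ]
  ((L ≡ pre ++ a ∷ b ∷ suf) × (M ≡ pre ++ (a + b) ∷ suf))

Refines : List ℕ → List ℕ → Set
Refines = Star Covers

HasSize : {X : Set} → (X → Set) → ℕ → Set
HasSize {X} P N = Σ (List X) (λ xs → Unique xs × (∀ x → (x ∈ xs) ⇔ P x) × (length xs ≡ N))

PairCond : List ℕ → List ℕ → List ℕ → List ℕ × List ℕ → Set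
PairCond π σ L (J , K) =
  WeakComp (length π) J × WeakComp (length σ) K
  × Refines J (CompPerm π) × Refines K (CompPerm σ)
  × (length J ≡ length L) × (length K ≡ length L)
  × (zipWith _+_ J K ≡ L)

module Submission where

-- Cut a word into consecutive blocks whose lengths form a weak composition L; "Blocks L τ" says
-- that τ increases on every block.  Both sides of the theorem are translated into blocks:
--   1. InS π σ τ  ⇔  τ is an interleaving of π and σ          (π, σ disjoint permutations);
--   2. Des τ ⊆ A  ⇔  Blocks (Comp A) τ                         (descents only at cut points);
--   3. J is a weak composition of |π| refining Comp(π)  ⇔  Blocks J π.
-- A block shuffle of τ records how its i-th block splits into Jᵢ letters of π and Kᵢ letters of
-- σ.  Every blocked interleaving τ has exactly one such splitting (J, K), and it satisfies
-- J + K = L; every pair (J, K) of blocked compositions with J + K = L comes from exactly one τ,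
-- obtained by merging the increasing blocks.  The blocked interleavings are counted by filtering
-- an explicit enumeration of all interleavings, and the one-to-one correspondence transfers
-- this number to the pairs (J, K).

open import Defs
open import Data.Nat using (ℕ; zero; suc; _+_; _∸_; _<_; _≤_; _<ᵇ_; _≤?_; _<?_; _≟_; z≤n; s≤s; z<s)
open import Data.Nat.Properties
open import Data.Nat.ListAction using (sum)
open import Data.Bool using (true; false; T)
open import Data.Bool.Properties using (T-≡)
open import Data.List using (List; []; _∷_; _++_; map; length; zipWith; filter)
open import Data.List.Properties using (∷-injectiveˡ; ∷-injectiveʳ)
open import Data.List.Relation.Unary.All as All using (All; []; _∷_)
open import Data.List.Relation.Unary.Any using (here; there)
open import Data.List.Relation.Unary.Linked using (Linked; []; [-]; _∷_)
open import Data.List.Relation.Unary.Linked.Properties using (Linked⇒All)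
open import Data.List.Relation.Unary.Unique.Propositional using (Unique)
open import Data.List.Relation.Unary.AllPairs.Core using ([]; _∷_)
import Data.List.Relation.Unary.Unique.Propositional.Properties as Unique
open import Data.List.Membership.Propositional using (_∈_; _∉_)
open import Data.List.Membership.Propositional.Properties
  using (∈-map⁺; ∈-map⁻; ∈-++⁺ˡ; ∈-++⁺ʳ; ∈-++⁻; ∈-filter⁺; ∈-filter⁻)
open import Data.List.Relation.Binary.Sublist.Propositional using (_⊆_; []; _∷_; _∷ʳ_)
open import Data.Product using (Σ; ∃-syntax; _×_; _,_; proj₁; proj₂)
open import Data.Product.Function.NonDependent.Propositional using (_×-⇔_)
open import Data.Sum using ([_,_]′)
open import Data.Empty using (⊥; ⊥-elim)
open import Data.Unit using (⊤; tt)
open import Function using (id)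
open import Function.Bundles using (_⇔_; mk⇔; Equivalence)
open import Function.Construct.Composition using (_⇔-∘_)
open import Relation.Binary.PropositionalEquality using (_≡_; _≢_; refl; sym; trans; cong; cong₂; subst)
open import Relation.Binary.Construct.Closure.ReflexiveTransitive using (ε; _◅_; gmap)
open import Relation.Nullary using (Dec; yes; no)
open import Relation.Nullary.Decidable using (_×-dec_)

open Equivalence using (to; from)

variable
  x y j k l : ℕ
  π σ τ τ′ r J J′ K K′ L M : List ℕ

data Interleaving : List ℕ → List ℕ → List ℕ → Set where
  []    : Interleaving [] [] []
  left  : Interleaving π σ τ → Interleaving (x ∷ π) σ (x ∷ τ)
  right : Interleaving π σ τ → Interleaving π (y ∷ σ) (y ∷ τ)

disjoint-tailˡ : Disjoint (x ∷ π) σ → Disjoint π σ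
disjoint-tailˡ d z z∈π = d z (there z∈π)

disjoint-tailʳ : Disjoint π (y ∷ σ) → Disjoint π σ
disjoint-tailʳ d z z∈π z∈σ = d z z∈π (there z∈σ)

disjoint-heads : Disjoint (x ∷ π) (x ∷ σ) → ⊥
disjoint-heads d = d _ (here refl) (here refl)

disjoint-heads-≤ : Disjoint (x ∷ π) (y ∷ σ) → x ≤ y → y ≤ x → ⊥
disjoint-heads-≤ d x≤y y≤x = d _ (here refl) (here (≤-antisym x≤y y≤x))

subsequences-length : Disjoint π σ → π ⊆ τ → σ ⊆ τ → length π + length σ ≤ length τ
subsequences-length d [] [] = ≤-refl
subsequences-length d (_ ∷ʳ p) (_ ∷ʳ q) = m≤n⇒m≤1+n (subsequences-length d p q)
subsequences-length d (refl ∷ p) (_ ∷ʳ q) = s≤s (subsequences-length (disjoint-tailˡ d) p q)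
subsequences-length {π} {_ ∷ σ} d (_ ∷ʳ p) (refl ∷ q) rewrite +-suc (length π) (length σ) =
  s≤s (subsequences-length (disjoint-tailʳ d) p q)
subsequences-length d (refl ∷ p) (refl ∷ q) = ⊥-elim (disjoint-heads d)

subsequences⇒interleaving : Disjoint π σ → π ⊆ τ → σ ⊆ τ → length τ ≡ length π + length σ
  → Interleaving π σ τ
subsequences⇒interleaving d [] [] e = []
subsequences⇒interleaving d (_ ∷ʳ p) (_ ∷ʳ q) e =
  ⊥-elim (<-irrefl refl (≤-trans (s≤s (subsequences-length d p q)) (≤-reflexive e)))
subsequences⇒interleaving d (refl ∷ p) (_ ∷ʳ q) e =
  left (subsequences⇒interleaving (disjoint-tailˡ d) p q (suc-injective e))
subsequences⇒interleaving {π} {_ ∷ σ} d (_ ∷ʳ p) (refl ∷ q) e =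
  right (subsequences⇒interleaving (disjoint-tailʳ d) p q
    (suc-injective (trans e (+-suc (length π) (length σ)))))
subsequences⇒interleaving d (refl ∷ p) (refl ∷ q) e = ⊥-elim (disjoint-heads d)

interleaving-length : Interleaving π σ τ → length τ ≡ length π + length σ
interleaving-length [] = refl
interleaving-length (left i) = cong suc (interleaving-length i)
interleaving-length {π} {_ ∷ σ} (right i) =
  trans (cong suc (interleaving-length i)) (sym (+-suc (length π) (length σ)))

interleaving-⊆ˡ : Interleaving π σ τ → π ⊆ τ
interleaving-⊆ˡ [] = []
interleaving-⊆ˡ (left i) = refl ∷ interleaving-⊆ˡ i
interleaving-⊆ˡ (right i) = _ ∷ʳ interleaving-⊆ˡ i

interleaving-⊆ʳ : Interleaving π σ τ → σ ⊆ τ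
interleaving-⊆ʳ [] = []
interleaving-⊆ʳ (left i) = _ ∷ʳ interleaving-⊆ʳ i
interleaving-⊆ʳ (right i) = refl ∷ interleaving-⊆ʳ i

interleaving-All : {P : ℕ → Set} → Interleaving π σ τ → All P π → All P σ → All P τ
interleaving-All [] _ _ = []
interleaving-All (left i) (p ∷ ps) qs = p ∷ interleaving-All i ps qs
interleaving-All (right i) ps (q ∷ qs) = q ∷ interleaving-All i ps qs

∉⇒All≢ : x ∉ π → All (x ≢_) π
∉⇒All≢ {π = []} _ = []
∉⇒All≢ {π = _ ∷ _} x∉ = (λ e → x∉ (here e)) ∷ ∉⇒All≢ (λ x∈ → x∉ (there x∈))

interleaving-IsPerm : IsPerm π → IsPerm σ → Disjoint π σ → Interleaving π σ τ → IsPerm τ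
interleaving-IsPerm _ _ _ [] = [] , []
interleaving-IsPerm (x∉π ∷ uπ , x>0 ∷ pπ) pσ d (left i) =
  let (uτ , pτ) = interleaving-IsPerm (uπ , pπ) pσ (disjoint-tailˡ d) i
  in interleaving-All i x∉π (∉⇒All≢ (d _ (here refl))) ∷ uτ , x>0 ∷ pτ
interleaving-IsPerm pπ (y∉σ ∷ uσ , y>0 ∷ pσ) d (right i) =
  let (uτ , pτ) = interleaving-IsPerm pπ (uσ , pσ) (disjoint-tailʳ d) i
  in interleaving-All i (∉⇒All≢ (λ y∈π → d _ y∈π (here refl))) y∉σ ∷ uτ , y>0 ∷ pτ

InS⇔Interleaving : IsPerm π → IsPerm σ → Disjoint π σ → InS π σ τ ⇔ Interleaving π σ τ
InS⇔Interleaving pπ pσ d = mk⇔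
  (λ (_ , e , p , q) → subsequences⇒interleaving d p q e)
  (λ i → interleaving-IsPerm pπ pσ d i , interleaving-length i , interleaving-⊆ˡ i , interleaving-⊆ʳ i)

-- AscendsInto x l τ: if the current block still has l > 0 letters after x, then x is at
-- most the next letter of τ.  Blocks L τ: cutting τ into consecutive segments of lengths
-- L₁, L₂, … (empty segments allowed) uses up τ exactly, and every segment is increasing.

AscendsInto : ℕ → ℕ → List ℕ → Set
AscendsInto x zero τ = ⊤
AscendsInto x (suc l) [] = ⊥
AscendsInto x (suc l) (y ∷ τ) = x ≤ y

Blocks : List ℕ → List ℕ → Set
Blocks [] τ = ⊥
Blocks (zero ∷ []) [] = ⊤
Blocks (zero ∷ []) (_ ∷ _) = ⊥
Blocks (zero ∷ l ∷ L) τ = Blocks (l ∷ L) τ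
Blocks (suc l ∷ L) [] = ⊥
Blocks (suc l ∷ L) (x ∷ τ) = AscendsInto x l τ × Blocks (l ∷ L) τ

blocks-cons-zero : ∀ L → Blocks L τ → Blocks (0 ∷ L) τ
blocks-cons-zero (_ ∷ _) b = b

des-descent : y < x → Des (x ∷ y ∷ r) ≡ 1 ∷ map suc (Des (y ∷ r))
des-descent y<x rewrite to T-≡ (<⇒<ᵇ y<x) = refl

des-ascent : x ≤ y → Des (x ∷ y ∷ r) ≡ map suc (Des (y ∷ r))
des-ascent {x} {y} x≤y with y <ᵇ x in eq
... | true = ⊥-elim (<⇒≱ (<ᵇ⇒< y x (subst T (sym eq) tt)) x≤y)
... | false = refl

-- DescentsIn p A τ: reading τ as occupying positions p + 1, p + 2, …, every descent of τ
-- sits at a position belonging to A.  The offset p makes the notion stable under tails.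
DescentsIn : ℕ → List ℕ → List ℕ → Set
DescentsIn p A [] = ⊤
DescentsIn p A (x ∷ []) = ⊤
DescentsIn p A (x ∷ y ∷ r) = (y < x → suc p ∈ A) × DescentsIn (suc p) A (y ∷ r)

shifted-positions : ∀ {p A} D
  → (∀ i → i ∈ map suc D → p + i ∈ A) ⇔ (∀ i → i ∈ D → suc p + i ∈ A)
shifted-positions {p} {A} D = mk⇔
  (λ f i i∈ → subst (_∈ A) (+-suc p i) (f (suc i) (∈-map⁺ suc i∈)))
  unshift
  where
  unshift : (∀ i → i ∈ D → suc p + i ∈ A) → ∀ i → i ∈ map suc D → p + i ∈ A
  unshift g i i∈ with ∈-map⁻ suc i∈
  ... | j , j∈ , refl = subst (_∈ A) (sym (+-suc p j)) (g j j∈)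

desSubset-step : ∀ {p A} x y r
  → (∀ i → i ∈ Des (y ∷ r) → suc p + i ∈ A) ⇔ DescentsIn (suc p) A (y ∷ r)
  → (∀ i → i ∈ Des (x ∷ y ∷ r) → p + i ∈ A) ⇔ DescentsIn p A (x ∷ y ∷ r)
desSubset-step {p} {A} x y r tail⇔ with y <? x
... | yes y<x rewrite des-descent {r = r} y<x = mk⇔
  (λ f → (λ _ → subst (_∈ A) (+-comm p 1) (f 1 (here refl)))
       , to tail⇔ (to (shifted-positions (Des (y ∷ r))) (λ i i∈ → f i (there i∈))))
  (λ { (g , h) i (here refl) → subst (_∈ A) (+-comm 1 p) (g y<x)
     ; (g , h) i (there i∈) → from (shifted-positions (Des (y ∷ r))) (from tail⇔ h) i i∈ })
... | no y≮x rewrite des-ascent {r = r} (≮⇒≥ y≮x) = mk⇔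
  (λ f → (λ y<x → ⊥-elim (y≮x y<x)) , to tail⇔ (to (shifted-positions (Des (y ∷ r))) f))
  (λ (_ , h) → from (shifted-positions (Des (y ∷ r))) (from tail⇔ h))

desSubset⇔descentsIn : ∀ p A τ → (∀ i → i ∈ Des τ → p + i ∈ A) ⇔ DescentsIn p A τ
desSubset⇔descentsIn p A [] = mk⇔ (λ _ → tt) (λ _ i ())
desSubset⇔descentsIn p A (x ∷ []) = mk⇔ (λ _ → tt) (λ _ i ())
desSubset⇔descentsIn p A (x ∷ y ∷ r) =
  desSubset-step x y r (desSubset⇔descentsIn (suc p) A (y ∷ r))

-- Descents versus blocks.  compAux N p A lists the distances between consecutive cut points
-- p < a₁ < ⋯ < aⱼ < N; nextCut N A is the first cut point after p.

nextCut : ℕ → List ℕ → ℕ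
nextCut N [] = N
nextCut N (a ∷ _) = a

∸-gap : ∀ q c → suc q < c → ∃[ l ] (c ∸ q ≡ suc (suc l) × c ∸ suc q ≡ suc l)
∸-gap zero (suc zero) (s≤s ())
∸-gap zero (suc (suc l)) _ = l , refl , refl
∸-gap (suc q) (suc c) (s≤s q<c) = ∸-gap q c q<c

compAux-open : ∀ N q A → suc q < nextCut N A
  → ∃[ l ] ∃[ L ] (compAux N q A ≡ suc (suc l) ∷ L × compAux N (suc q) A ≡ suc l ∷ L)
compAux-open N q [] gap =
  let (l , e₁ , e₂) = ∸-gap q N gap in l , [] , cong (_∷ []) e₁ , cong (_∷ []) e₂
compAux-open N q (a ∷ A) gap =
  let (l , e₁ , e₂) = ∸-gap q a gap
  in l , compAux N a A , cong (_∷ compAux N a A) e₁ , cong (_∷ compAux N a A) e₂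

-- compAux always produces a nonempty list, so a leading empty block may be added or removed.
blocks-pad-zero : ∀ N q A → Blocks (compAux N q A) τ ⇔ Blocks (0 ∷ compAux N q A) τ
blocks-pad-zero N q [] = mk⇔ id id
blocks-pad-zero N q (a ∷ A) = mk⇔ id id

-- DescentsIn q only asks about positions beyond q, so a cut point a ≤ q is irrelevant.
descentsIn-drop : ∀ {a q A} τ → a ≤ q → DescentsIn q (a ∷ A) τ ⇔ DescentsIn q A τ
descentsIn-drop [] a≤q = mk⇔ id id
descentsIn-drop (x ∷ []) a≤q = mk⇔ id id
descentsIn-drop {a} {q} {A} (x ∷ y ∷ r) a≤q =
  mk⇔ (λ f y<x → skip (f y<x)) (λ f y<x → there (f y<x)) ×-⇔ descentsIn-drop (y ∷ r) (m≤n⇒m≤1+n a≤q)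
  where
  skip : suc q ∈ a ∷ A → suc q ∈ A
  skip (here refl) = ⊥-elim (<-irrefl refl a≤q)
  skip (there i∈) = i∈

-- Position p + 1 is not a cut point: there the letters x, y must ascend.
no-cut-step : ∀ {p A N} → suc p ∉ A → suc p < nextCut N A
  → DescentsIn (suc p) A (y ∷ r) ⇔ Blocks (compAux N (suc p) A) (y ∷ r)
  → DescentsIn p A (x ∷ y ∷ r) ⇔ Blocks (compAux N p A) (x ∷ y ∷ r)
no-cut-step {y} {r} {x} {p} {A} {N} p+1∉A gap tail⇔ with compAux-open N p A gap
... | l , L , e₁ , e₂ =
  subst (λ C → DescentsIn p A (x ∷ y ∷ r) ⇔ Blocks C (x ∷ y ∷ r)) (sym e₁)
    (must-ascend ×-⇔ subst (λ C → DescentsIn (suc p) A (y ∷ r) ⇔ Blocks C (y ∷ r)) e₂ tail⇔)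
  where
  must-ascend : (y < x → suc p ∈ A) ⇔ x ≤ y
  must-ascend = mk⇔ (λ f → ≮⇒≥ (λ y<x → p+1∉A (f y<x))) (λ x≤y y<x → ⊥-elim (<⇒≱ y<x x≤y))

-- Position p + 1 is a cut point: any order of x, y is allowed, and x forms a block of its own.
cut-step : ∀ {p A N} → DescentsIn (suc p) A (y ∷ r) ⇔ Blocks (compAux N (suc p) A) (y ∷ r)
  → DescentsIn p (suc p ∷ A) (x ∷ y ∷ r) ⇔ Blocks (compAux N p (suc p ∷ A)) (x ∷ y ∷ r)
cut-step {y} {r} {x} {p} {A} {N} tail⇔ rewrite m+n∸n≡m 1 p =
  mk⇔ (λ _ → tt) (λ _ _ → here refl)
    ×-⇔ (blocks-pad-zero N (suc p) A ⇔-∘ (tail⇔ ⇔-∘ descentsIn-drop (y ∷ r) ≤-refl))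

prepend-letter : ∀ {p N} x y r → N ≡ suc p + length (y ∷ r)
  → (∀ B → Linked _<_ (suc p ∷ B) → All (_< N) B
       → DescentsIn (suc p) B (y ∷ r) ⇔ Blocks (compAux N (suc p) B) (y ∷ r))
  → ∀ A → Linked _<_ (p ∷ A) → All (_< N) A
  → DescentsIn p A (x ∷ y ∷ r) ⇔ Blocks (compAux N p A) (x ∷ y ∷ r)
prepend-letter {p} x y r N≡ tail⇔ [] _ _ =
  no-cut-step (λ ()) (subst (suc p <_) (sym N≡) (m<m+n (suc p) z<s)) (tail⇔ [] [-] [])
prepend-letter {p} x y r N≡ tail⇔ (a ∷ A) (p<a ∷ linked) (a<N ∷ bounded) with a ≟ suc p
... | yes refl = cut-step (tail⇔ A linked bounded)
... | no a≢p+1 = no-cut-step p+1∉ p+1<a (tail⇔ (a ∷ A) (p+1<a ∷ linked) (a<N ∷ bounded))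
  where
  p+1<a : suc p < a
  p+1<a = ≤∧≢⇒< p<a (λ e → a≢p+1 (sym e))
  p+1∉ : suc p ∉ a ∷ A
  p+1∉ p+1∈ = <-irrefl refl (All.lookup (Linked⇒All <-trans p+1<a linked) p+1∈)

no-interior-cut : ∀ {p a k} → k ≤ 1 → p < a → a < p + k → ⊥
no-interior-cut {p} {a} {k} k≤1 p<a a<p+k =
  <-irrefl refl (subst (suc (suc p) ≤_) (+-comm p 1)
    (≤-trans (s≤s p<a) (≤-trans a<p+k (+-monoʳ-≤ p k≤1))))

descents⇔blocks : ∀ τ p A N → N ≡ p + length τ → Linked _<_ (p ∷ A) → All (_< N) A
  → DescentsIn p A τ ⇔ Blocks (compAux N p A) τ
descents⇔blocks [] p [] _ refl _ _ rewrite m+n∸m≡n p 0 = mk⇔ id id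
descents⇔blocks (x ∷ []) p [] _ refl _ _ rewrite m+n∸m≡n p 1 = mk⇔ (λ _ → tt , tt) (λ _ → tt)
descents⇔blocks [] p (a ∷ _) _ refl (p<a ∷ _) (a<N ∷ _) = ⊥-elim (no-interior-cut z≤n p<a a<N)
descents⇔blocks (x ∷ []) p (a ∷ _) _ refl (p<a ∷ _) (a<N ∷ _) = ⊥-elim (no-interior-cut ≤-refl p<a a<N)
descents⇔blocks (x ∷ y ∷ r) p A N N≡ =
  prepend-letter x y r N≡′ (λ B → descents⇔blocks (y ∷ r) (suc p) B N N≡′) A
  where
  N≡′ : N ≡ suc p + length (y ∷ r)
  N≡′ = trans N≡ (+-suc p (length (y ∷ r)))

desSubset⇔blocks : ∀ τ A N → N ≡ length τ → Linked _<_ A → All (λ a → (0 < a) × (a < N)) A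
  → (∀ i → i ∈ Des τ → i ∈ A) ⇔ Blocks (Comp N A) τ
desSubset⇔blocks τ A N N≡ linked bounds =
  descents⇔blocks τ 0 A N N≡ (above-zero linked bounds) (All.map proj₂ bounds)
    ⇔-∘ desSubset⇔descentsIn 0 A τ
  where
  above-zero : ∀ {A} → Linked _<_ A → All (λ a → (0 < a) × (a < N)) A → Linked _<_ (0 ∷ A)
  above-zero [] [] = [-]
  above-zero linked ((0<a , _) ∷ _) = 0<a ∷ linked

incHead : List ℕ → List ℕ
incHead [] = 1 ∷ []
incHead (h ∷ t) = suc h ∷ t

compAux-shift : ∀ N p D → compAux (suc N) (suc p) (map suc D) ≡ compAux N p D
compAux-shift N p [] = refl
compAux-shift N p (d ∷ D) = cong (d ∸ p ∷_) (compAux-shift N d D)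

compAux-incHead : ∀ N D → compAux (suc N) 0 (map suc D) ≡ incHead (compAux N 0 D)
compAux-incHead N [] = refl
compAux-incHead N (d ∷ D) = cong (suc d ∷_) (compAux-shift N d D)

compPerm-descent : y < x → CompPerm (x ∷ y ∷ r) ≡ 1 ∷ CompPerm (y ∷ r)
compPerm-descent {y} {x} {r} y<x rewrite des-descent {r = r} y<x =
  cong (1 ∷_) (compAux-shift (length (y ∷ r)) 0 (Des (y ∷ r)))

compPerm-ascent : x ≤ y → CompPerm (x ∷ y ∷ r) ≡ incHead (CompPerm (y ∷ r))
compPerm-ascent {x} {y} {r} x≤y rewrite des-ascent {r = r} x≤y =
  compAux-incHead (length (y ∷ r)) (Des (y ∷ r))

blocks-extend : ∀ C → x ≤ y → Blocks C (y ∷ r) → Blocks (incHead C) (x ∷ y ∷ r)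
blocks-extend (zero ∷ _) _ b = tt , b
blocks-extend (suc _ ∷ _) x≤y b = x≤y , b

blocks-compPerm-cons : ∀ x y r → Blocks (CompPerm (y ∷ r)) (y ∷ r)
  → Blocks (CompPerm (x ∷ y ∷ r)) (x ∷ y ∷ r)
blocks-compPerm-cons x y r b with y <? x
... | yes y<x = subst (λ C → Blocks C (x ∷ y ∷ r)) (sym (compPerm-descent {r = r} y<x))
  (tt , to (blocks-pad-zero (length (y ∷ r)) 0 (Des (y ∷ r))) b)
... | no y≮x = subst (λ C → Blocks C (x ∷ y ∷ r)) (sym (compPerm-ascent {r = r} (≮⇒≥ y≮x)))
  (blocks-extend (CompPerm (y ∷ r)) (≮⇒≥ y≮x) b)

blocks-compPerm : ∀ (π : List ℕ) → Blocks (CompPerm π) π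
blocks-compPerm [] = tt
blocks-compPerm (x ∷ []) = tt , tt
blocks-compPerm (x ∷ y ∷ r) = blocks-compPerm-cons x y r (blocks-compPerm (y ∷ r))

incHead-refines : Refines L M → Refines (incHead L) (incHead M)
incHead-refines = gmap incHead covers
  where
  covers : Covers L M → Covers (incHead L) (incHead M)
  covers ([] , a , b , suf , refl , refl) = [] , suc a , b , suf , refl , refl
  covers (p ∷ pre , a , b , suf , refl , refl) = suc p ∷ pre , a , b , suf , refl , refl

cons-refines : ∀ c → Refines L M → Refines (c ∷ L) (c ∷ M)
cons-refines c = gmap (c ∷_) λ (pre , a , b , suf , L≡ , M≡) →
  c ∷ pre , a , b , suf , cong (c ∷_) L≡ , cong (c ∷_) M≡

singleton-block-refines : ∀ {l J} x y r → Refines (l ∷ J) (CompPerm (y ∷ r))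
  → Refines (1 ∷ l ∷ J) (CompPerm (x ∷ y ∷ r))
singleton-block-refines {l} {J} x y r J≤ with y <? x
... | yes y<x = subst (Refines _) (sym (compPerm-descent {r = r} y<x)) (cons-refines 1 J≤)
... | no y≮x = subst (Refines _) (sym (compPerm-ascent {r = r} (≮⇒≥ y≮x)))
  (incHead-refines (([] , 0 , l , J , refl , refl) ◅ J≤))

-- A weak composition J on whose blocks π increases refines the descent composition of π: each
-- descent of π is forced to be a cut between blocks of J.
blocks⇒refines : ∀ J (π : List ℕ) → Blocks J π → Refines J (CompPerm π)
blocks⇒refines (zero ∷ []) [] _ = ε
blocks⇒refines (zero ∷ l ∷ J) π b = ([] , 0 , l , J , refl , refl) ◅ blocks⇒refines (l ∷ J) π b
blocks⇒refines (suc j ∷ J) (x ∷ []) (_ , b) = incHead-refines (blocks⇒refines (j ∷ J) [] b)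
blocks⇒refines (1 ∷ l ∷ J) (x ∷ y ∷ r) (_ , b) =
  singleton-block-refines x y r (blocks⇒refines (l ∷ J) (y ∷ r) b)
blocks⇒refines (suc (suc j) ∷ J) (x ∷ y ∷ r) (x≤y , b) =
  subst (Refines _) (sym (compPerm-ascent {r = r} x≤y))
    (incHead-refines (blocks⇒refines (suc j ∷ J) (y ∷ r) b))

ascendsInto-weaken : ∀ a b → AscendsInto x (a + b) τ → AscendsInto x a τ
ascendsInto-weaken zero b _ = tt
ascendsInto-weaken {τ = _ ∷ _} (suc a) b x≤y = x≤y

blocks-split : ∀ pre a b suf π → Blocks (pre ++ (a + b) ∷ suf) π → Blocks (pre ++ a ∷ b ∷ suf) π
blocks-split [] zero b suf π h = h
blocks-split [] (suc a) b suf (x ∷ π) (asc , h) =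
  ascendsInto-weaken a b asc , blocks-split [] a b suf π h
blocks-split (zero ∷ []) a b suf π h = blocks-split [] a b suf π h
blocks-split (zero ∷ q ∷ pre) a b suf π h = blocks-split (q ∷ pre) a b suf π h
blocks-split (suc q ∷ pre) a b suf (x ∷ π) (asc , h) = asc , blocks-split (q ∷ pre) a b suf π h

refines⇒blocks : Refines L M → Blocks M π → Blocks L π
refines⇒blocks ε b = b
refines⇒blocks {π = π} ((pre , a , b , suf , refl , refl) ◅ s) h =
  blocks-split pre a b suf π (refines⇒blocks s h)

sum-blocks : ∀ J π → Blocks J π → sum J ≡ length π
sum-blocks (zero ∷ []) [] _ = refl
sum-blocks (zero ∷ l ∷ J) π b = sum-blocks (l ∷ J) π b
sum-blocks (suc j ∷ J) (x ∷ π) (_ , b) = cong suc (sum-blocks (j ∷ J) π b)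

refines⇔blocks : ∀ J π → (WeakComp (length π) J × Refines J (CompPerm π)) ⇔ Blocks J π
refines⇔blocks J π = mk⇔
  (λ (_ , J≤) → refines⇒blocks J≤ (blocks-compPerm π))
  (λ b → sum-blocks J π b , blocks⇒refines J π b)

-- BlockShuffle J K L π σ τ: τ interleaves π and σ and is increasing on the
-- blocks of L, the i-th block consisting of Jᵢ letters of π and Kᵢ letters of σ.  The heads of
-- J, K, L count what is still missing from the current (first) block.

data BlockShuffle : List ℕ → List ℕ → List ℕ → List ℕ → List ℕ → List ℕ → Set where
  done     : BlockShuffle (0 ∷ []) (0 ∷ []) (0 ∷ []) [] [] []
  newBlock : BlockShuffle J K L π σ τ → BlockShuffle (0 ∷ J) (0 ∷ K) (0 ∷ L) π σ τ
  takeˡ    : AscendsInto x l τ → BlockShuffle (j ∷ J) (k ∷ K) (l ∷ L) π σ τ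
           → BlockShuffle (suc j ∷ J) (k ∷ K) (suc l ∷ L) (x ∷ π) σ (x ∷ τ)
  takeʳ    : AscendsInto y l τ → BlockShuffle (j ∷ J) (k ∷ K) (l ∷ L) π σ τ
           → BlockShuffle (j ∷ J) (suc k ∷ K) (suc l ∷ L) π (y ∷ σ) (y ∷ τ)

ascendsInto-trans : ∀ {z} n → x ≤ z → AscendsInto z n τ → AscendsInto x n τ
ascendsInto-trans zero _ _ = tt
ascendsInto-trans {τ = _ ∷ _} (suc n) x≤z z≤w = ≤-trans x≤z z≤w

ascends-split : BlockShuffle (j ∷ J) (k ∷ K) (l ∷ L) π σ τ → AscendsInto x l τ
  → AscendsInto x j π × AscendsInto x k σ
ascends-split done _ = tt , tt
ascends-split (newBlock _) _ = tt , tt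
ascends-split {k = zero} (takeˡ _ _) x≤x′ = x≤x′ , tt
ascends-split {k = suc k} (takeˡ asc v) x≤x′ =
  x≤x′ , ascendsInto-trans (suc k) x≤x′ (proj₂ (ascends-split v asc))
ascends-split {j = zero} (takeʳ _ _) x≤y = tt , x≤y
ascends-split {j = suc j} (takeʳ asc v) x≤y =
  ascendsInto-trans (suc j) x≤y (proj₁ (ascends-split v asc)) , x≤y

ascends-merge : BlockShuffle (j ∷ J) (k ∷ K) (l ∷ L) π σ τ
  → AscendsInto x j π → AscendsInto x k σ → AscendsInto x l τ
ascends-merge done _ _ = tt
ascends-merge (newBlock _) _ _ = tt
ascends-merge (takeˡ _ _) x≤x′ _ = x≤x′
ascends-merge (takeʳ _ _) _ x≤y = x≤y

shuffle-blocksˡ : BlockShuffle J K L π σ τ → Blocks J π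
shuffle-blocksˡ done = tt
shuffle-blocksˡ (newBlock {J = J} v) = blocks-cons-zero J (shuffle-blocksˡ v)
shuffle-blocksˡ (takeˡ asc v) = proj₁ (ascends-split v asc) , shuffle-blocksˡ v
shuffle-blocksˡ (takeʳ _ v) = shuffle-blocksˡ v

shuffle-blocksʳ : BlockShuffle J K L π σ τ → Blocks K σ
shuffle-blocksʳ done = tt
shuffle-blocksʳ (newBlock {K = K} v) = blocks-cons-zero K (shuffle-blocksʳ v)
shuffle-blocksʳ (takeˡ _ v) = shuffle-blocksʳ v
shuffle-blocksʳ (takeʳ asc v) = proj₂ (ascends-split v asc) , shuffle-blocksʳ v

shuffle-blocks : BlockShuffle J K L π σ τ → Blocks L τ
shuffle-blocks done = tt
shuffle-blocks (newBlock {L = L} v) = blocks-cons-zero L (shuffle-blocks v)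
shuffle-blocks (takeˡ asc v) = asc , shuffle-blocks v
shuffle-blocks (takeʳ asc v) = asc , shuffle-blocks v

shuffle-interleaving : BlockShuffle J K L π σ τ → Interleaving π σ τ
shuffle-interleaving done = []
shuffle-interleaving (newBlock v) = shuffle-interleaving v
shuffle-interleaving (takeˡ _ v) = left (shuffle-interleaving v)
shuffle-interleaving (takeʳ _ v) = right (shuffle-interleaving v)

shuffle-sum : BlockShuffle J K L π σ τ → zipWith _+_ J K ≡ L
shuffle-sum done = refl
shuffle-sum (newBlock v) = cong (0 ∷_) (shuffle-sum v)
shuffle-sum (takeˡ _ v) = cong incHead (shuffle-sum v)
shuffle-sum (takeʳ {j = j} {J = J} {k = k} {K = K} _ v) =
  trans (cong (_∷ zipWith _+_ J K) (+-suc j k)) (cong incHead (shuffle-sum v))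

shuffle-lengths : BlockShuffle J K L π σ τ → (length J ≡ length L) × (length K ≡ length L)
shuffle-lengths done = refl , refl
shuffle-lengths (newBlock v) = let (eJ , eK) = shuffle-lengths v in cong suc eJ , cong suc eK
shuffle-lengths (takeˡ _ v) = shuffle-lengths v
shuffle-lengths (takeʳ _ v) = shuffle-lengths v

shuffle-consˡ : AscendsInto x l τ → ∃[ J ] ∃[ K ] BlockShuffle J K (l ∷ L) π σ τ
  → ∃[ J ] ∃[ K ] BlockShuffle J K (suc l ∷ L) (x ∷ π) σ (x ∷ τ)
shuffle-consˡ asc (j ∷ J , k ∷ K , v) = suc j ∷ J , k ∷ K , takeˡ asc v

shuffle-consʳ : AscendsInto y l τ → ∃[ J ] ∃[ K ] BlockShuffle J K (l ∷ L) π σ τ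
  → ∃[ J ] ∃[ K ] BlockShuffle J K (suc l ∷ L) π (y ∷ σ) (y ∷ τ)
shuffle-consʳ asc (j ∷ J , k ∷ K , v) = j ∷ J , suc k ∷ K , takeʳ asc v

blocks⇒shuffle : ∀ L τ → Interleaving π σ τ → Blocks L τ → ∃[ J ] ∃[ K ] BlockShuffle J K L π σ τ
blocks⇒shuffle (zero ∷ []) [] [] _ = _ , _ , done
blocks⇒shuffle (zero ∷ l ∷ L) τ i b =
  let (J , K , v) = blocks⇒shuffle (l ∷ L) τ i b in 0 ∷ J , 0 ∷ K , newBlock v
blocks⇒shuffle (suc l ∷ L) (x ∷ τ) (left i) (asc , b) = shuffle-consˡ asc (blocks⇒shuffle (l ∷ L) τ i b)
blocks⇒shuffle (suc l ∷ L) (y ∷ τ) (right i) (asc , b) = shuffle-consʳ asc (blocks⇒shuffle (l ∷ L) τ i b)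

-- Existence, from the composition side: merging the increasing blocks of π and σ block by
-- block, always taking the smaller available letter first.
merge-consˡ : AscendsInto x j π → AscendsInto x k σ → ∃[ L ] ∃[ τ ] BlockShuffle (j ∷ J) (k ∷ K) L π σ τ
  → ∃[ L ] ∃[ τ ] BlockShuffle (suc j ∷ J) (k ∷ K) L (x ∷ π) σ τ
merge-consˡ {x = x} ascπ ascσ (l ∷ L , τ , v) = suc l ∷ L , x ∷ τ , takeˡ (ascends-merge v ascπ ascσ) v

merge-consʳ : AscendsInto y j π → AscendsInto y k σ → ∃[ L ] ∃[ τ ] BlockShuffle (j ∷ J) (k ∷ K) L π σ τ
  → ∃[ L ] ∃[ τ ] BlockShuffle (j ∷ J) (suc k ∷ K) L π (y ∷ σ) τ
merge-consʳ {y = y} ascπ ascσ (l ∷ L , τ , v) = suc l ∷ L , y ∷ τ , takeʳ (ascends-merge v ascπ ascσ) v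

blocks-merge : ∀ J K π σ → Blocks J π → Blocks K σ → length J ≡ length K
  → ∃[ L ] ∃[ τ ] BlockShuffle J K L π σ τ
blocks-merge (zero ∷ []) (zero ∷ []) [] [] _ _ _ = _ , _ , done
blocks-merge (zero ∷ j ∷ J) (zero ∷ k ∷ K) π σ a b e =
  let (L , τ , v) = blocks-merge (j ∷ J) (k ∷ K) π σ a b (suc-injective e) in 0 ∷ L , τ , newBlock v
blocks-merge (suc j ∷ J) (zero ∷ K) (x ∷ π) σ (ascˣ , a) b e =
  merge-consˡ ascˣ tt (blocks-merge (j ∷ J) (zero ∷ K) π σ a b e)
blocks-merge (zero ∷ J) (suc k ∷ K) π (y ∷ σ) a (ascʸ , b) e =
  merge-consʳ tt ascʸ (blocks-merge (zero ∷ J) (k ∷ K) π σ a b e)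
blocks-merge (suc j ∷ J) (suc k ∷ K) (x ∷ π) (y ∷ σ) (ascˣ , a) (ascʸ , b) e =
  [ (λ x≤y → merge-consˡ ascˣ x≤y (blocks-merge (j ∷ J) (suc k ∷ K) π (y ∷ σ) a (ascʸ , b) e))
  , (λ y<x → merge-consʳ (<⇒≤ y<x) ascʸ (blocks-merge (suc j ∷ J) (k ∷ K) (x ∷ π) σ (ascˣ , a) b e))
  ]′ (≤-<-connex x y)

-- Uniqueness.  For disjoint π and σ, the letters of τ reveal which word each comes from, and L
-- reveals where the blocks end; so (J, K) is determined by τ.
shuffle-split-unique : Disjoint π σ → BlockShuffle J K L π σ τ → BlockShuffle J′ K′ L π σ τ
  → (J ≡ J′) × (K ≡ K′)
shuffle-split-unique d done done = refl , refl
shuffle-split-unique d (newBlock v) (newBlock w) =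
  let (eJ , eK) = shuffle-split-unique d v w in cong (0 ∷_) eJ , cong (0 ∷_) eK
shuffle-split-unique d (takeˡ _ v) (takeˡ _ w) =
  let (eJ , eK) = shuffle-split-unique (disjoint-tailˡ d) v w in cong incHead eJ , eK
shuffle-split-unique d (takeʳ _ v) (takeʳ _ w) =
  let (eJ , eK) = shuffle-split-unique (disjoint-tailʳ d) v w in eJ , cong incHead eK
shuffle-split-unique d (takeˡ _ _) (takeʳ _ _) = ⊥-elim (disjoint-heads d)
shuffle-split-unique d (takeʳ _ _) (takeˡ _ _) = ⊥-elim (disjoint-heads d)

-- Conversely τ is determined by (J, K): when the current blocks of π and σ both still have
-- letters, the smaller of their next letters must come first.
shuffle-word-unique : Disjoint π σ → BlockShuffle J K L π σ τ → BlockShuffle J K L π σ τ′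
  → τ ≡ τ′
shuffle-word-unique d done done = refl
shuffle-word-unique d (newBlock v) (newBlock w) = shuffle-word-unique d v w
shuffle-word-unique d (takeˡ _ v) (takeˡ _ w) = cong (_ ∷_) (shuffle-word-unique (disjoint-tailˡ d) v w)
shuffle-word-unique d (takeʳ _ v) (takeʳ _ w) = cong (_ ∷_) (shuffle-word-unique (disjoint-tailʳ d) v w)
shuffle-word-unique d (takeˡ ascˣ v) (takeʳ ascʸ w) =
  ⊥-elim (disjoint-heads-≤ d (proj₂ (ascends-split v ascˣ)) (proj₁ (ascends-split w ascʸ)))
shuffle-word-unique d (takeʳ ascʸ v) (takeˡ ascˣ w) =
  ⊥-elim (disjoint-heads-≤ d (proj₂ (ascends-split w ascˣ)) (proj₁ (ascends-split v ascʸ)))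

interleavings : List ℕ → List ℕ → List (List ℕ)
interleavings [] [] = [] ∷ []
interleavings (x ∷ π) [] = map (x ∷_) (interleavings π [])
interleavings [] (y ∷ σ) = map (y ∷_) (interleavings [] σ)
interleavings (x ∷ π) (y ∷ σ) =
  map (x ∷_) (interleavings π (y ∷ σ)) ++ map (y ∷_) (interleavings (x ∷ π) σ)

interleavings-complete : Interleaving π σ τ → τ ∈ interleavings π σ
interleavings-complete [] = here refl
interleavings-complete (left {σ = []} i) = ∈-map⁺ _ (interleavings-complete i)
interleavings-complete (left {σ = _ ∷ _} i) = ∈-++⁺ˡ (∈-map⁺ _ (interleavings-complete i))
interleavings-complete (right {π = []} i) = ∈-map⁺ _ (interleavings-complete i)
interleavings-complete (right {π = x ∷ π} i) =
  ∈-++⁺ʳ (map (x ∷_) _) (∈-map⁺ _ (interleavings-complete i))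

listed-after-left : (∀ {τ} → τ ∈ interleavings π σ → Interleaving π σ τ)
  → τ ∈ map (x ∷_) (interleavings π σ) → Interleaving (x ∷ π) σ τ
listed-after-left sound τ∈ with ∈-map⁻ _ τ∈
... | _ , τ′∈ , refl = left (sound τ′∈)

listed-after-right : (∀ {τ} → τ ∈ interleavings π σ → Interleaving π σ τ)
  → τ ∈ map (y ∷_) (interleavings π σ) → Interleaving π (y ∷ σ) τ
listed-after-right sound τ∈ with ∈-map⁻ _ τ∈
... | _ , τ′∈ , refl = right (sound τ′∈)

interleavings-sound : ∀ π σ {τ} → τ ∈ interleavings π σ → Interleaving π σ τ
interleavings-sound [] [] (here refl) = []
interleavings-sound (x ∷ π) [] = listed-after-left (interleavings-sound π [])
interleavings-sound [] (y ∷ σ) = listed-after-right (interleavings-sound [] σ)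
interleavings-sound (x ∷ π) (y ∷ σ) τ∈ =
  [ listed-after-left (interleavings-sound π (y ∷ σ))
  , listed-after-right (interleavings-sound (x ∷ π) σ) ]′
    (∈-++⁻ (map (x ∷_) (interleavings π (y ∷ σ))) τ∈)

-- For disjoint words no interleaving is listed twice: the two halves of the list start with
-- different letters.
interleavings-unique : ∀ π σ → Disjoint π σ → Unique (interleavings π σ)
interleavings-unique [] [] _ = [] ∷ []
interleavings-unique (x ∷ π) [] d =
  Unique.map⁺ ∷-injectiveʳ (interleavings-unique π [] (disjoint-tailˡ d))
interleavings-unique [] (y ∷ σ) d =
  Unique.map⁺ ∷-injectiveʳ (interleavings-unique [] σ (disjoint-tailʳ d))
interleavings-unique (x ∷ π) (y ∷ σ) d =
  Unique.++⁺ (Unique.map⁺ ∷-injectiveʳ (interleavings-unique π (y ∷ σ) (disjoint-tailˡ d)))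
             (Unique.map⁺ ∷-injectiveʳ (interleavings-unique (x ∷ π) σ (disjoint-tailʳ d)))
             λ (τ∈ˡ , τ∈ʳ) →
               let (_ , _ , eˡ) = ∈-map⁻ _ τ∈ˡ
                   (_ , _ , eʳ) = ∈-map⁻ _ τ∈ʳ
               in d x (here refl) (here (∷-injectiveˡ (trans (sym eˡ) eʳ)))

ascendsInto? : ∀ x l τ → Dec (AscendsInto x l τ)
ascendsInto? x zero τ = yes tt
ascendsInto? x (suc l) [] = no λ ()
ascendsInto? x (suc l) (y ∷ τ) = x ≤? y

blocks? : ∀ L τ → Dec (Blocks L τ)
blocks? [] τ = no λ ()
blocks? (zero ∷ []) [] = yes tt
blocks? (zero ∷ []) (_ ∷ _) = no λ ()
blocks? (zero ∷ l ∷ L) τ = blocks? (l ∷ L) τ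
blocks? (suc l ∷ L) [] = no λ ()
blocks? (suc l ∷ L) (x ∷ τ) = ascendsInto? x l τ ×-dec blocks? (l ∷ L) τ

HasSize-resp : ∀ {X : Set} {P Q : X → Set} {n} → (∀ x → P x ⇔ Q x) → HasSize P n → HasSize Q n
HasSize-resp P⇔Q (xs , u , listed , len) = xs , u , (λ x → P⇔Q x ⇔-∘ listed x) , len

blocked-interleavings-size : ∀ L → Disjoint π σ
  → HasSize (λ τ → Interleaving π σ τ × Blocks L τ) (length (filter (blocks? L) (interleavings π σ)))
blocked-interleavings-size {π} {σ} L d =
  filter (blocks? L) (interleavings π σ) , Unique.filter⁺ (blocks? L) (interleavings-unique π σ d) ,
  (λ τ → mk⇔ (λ τ∈ → let (τ∈′ , b) = ∈-filter⁻ (blocks? L) τ∈ in interleavings-sound π σ τ∈′ , b)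
             (λ (i , b) → ∈-filter⁺ (blocks? L) (interleavings-complete i) b)) ,
  refl

record Correspondence {X Y : Set} (P : X → Set) (Q : Y → Set) : Set₁ where
  field
    R          : X → Y → Set
    image      : ∀ {x y} → R x y → Q y
    forth      : ∀ {x} → P x → Σ Y (R x)
    back       : ∀ {y} → Q y → Σ X λ x → P x × R x y
    functional : ∀ {x y y′} → R x y → R x y′ → y ≡ y′
    injective  : ∀ {x x′ y} → R x y → R x′ y → x ≡ x′

-- Corresponding sets have the same size: the images of a duplicate-free listing of P form a
-- duplicate-free listing of Q.
module _ {X Y : Set} {P : X → Set} {Q : Y → Set} (C : Correspondence P Q) where
  open Correspondence C

  images : ∀ {xs} → All P xs → List Y
  images [] = []
  images (p ∷ ps) = proj₁ (forth p) ∷ images ps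

  images-length : ∀ {xs} (ps : All P xs) → length (images ps) ≡ length xs
  images-length [] = refl
  images-length (p ∷ ps) = cong suc (images-length ps)

  images-sound : ∀ {xs y} (ps : All P xs) → y ∈ images ps → Σ X λ x → x ∈ xs × R x y
  images-sound (p ∷ ps) (here refl) = _ , here refl , proj₂ (forth p)
  images-sound (p ∷ ps) (there y∈) = let (x , x∈ , r) = images-sound ps y∈ in x , there x∈ , r

  images-complete : ∀ {xs x y} (ps : All P xs) → x ∈ xs → R x y → y ∈ images ps
  images-complete (p ∷ ps) (here refl) r = here (functional r (proj₂ (forth p)))
  images-complete (p ∷ ps) (there x∈) r = there (images-complete ps x∈ r)

  images-unique : ∀ {xs} (ps : All P xs) → Unique xs → Unique (images ps)
  images-unique [] [] = []
  images-unique (p ∷ ps) (x∉ ∷ u) =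
    All.tabulate (λ y∈ y₀≡y →
      let (x′ , x′∈ , r) = images-sound ps y∈
      in All.lookup x∉ x′∈ (injective (proj₂ (forth p)) (subst (R x′) (sym y₀≡y) r)))
    ∷ images-unique ps u

  HasSize-transfer : ∀ {n} → HasSize P n → HasSize Q n
  HasSize-transfer (xs , u , listed , len) =
    images ps , images-unique ps u ,
    (λ y → mk⇔ (λ y∈ → image (proj₂ (proj₂ (images-sound ps y∈))))
               (λ q → let (x , p , r) = back q in images-complete ps (from (listed x) p) r)) ,
    trans (images-length ps) len
    where
    ps : All P xs
    ps = All.tabulate (λ {x} x∈ → to (listed x) x∈)

block-shuffle-correspondence : ∀ {π σ} L → Disjoint π σ
  → Correspondence (λ τ → Interleaving π σ τ × Blocks L τ) (PairCond π σ L)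
block-shuffle-correspondence {π} {σ} L d = record
  { R          = λ τ JK → BlockShuffle (proj₁ JK) (proj₂ JK) L π σ τ
  ; image      = image
  ; forth      = λ {τ} (i , b) → let (J , K , v) = blocks⇒shuffle L τ i b in (J , K) , v
  ; back       = back
  ; functional = λ v w → let (eJ , eK) = shuffle-split-unique d v w in cong₂ _,_ eJ eK
  ; injective  = shuffle-word-unique d
  }
  where
  image : ∀ {τ J K} → BlockShuffle J K L π σ τ → PairCond π σ L (J , K)
  image {J = J} {K} v =
    let (wJ , J≤) = from (refines⇔blocks J π) (shuffle-blocksˡ v)
        (wK , K≤) = from (refines⇔blocks K σ) (shuffle-blocksʳ v)
        (lJ , lK) = shuffle-lengths v
    in wJ , wK , J≤ , K≤ , lJ , lK , shuffle-sum v
  back : ∀ {JK} → PairCond π σ L JK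
    → Σ (List ℕ) λ τ → (Interleaving π σ τ × Blocks L τ)
                      × BlockShuffle (proj₁ JK) (proj₂ JK) L π σ τ
  back {J , K} (wJ , wK , J≤ , K≤ , lJ , lK , J+K≡L) =
    let (L′ , τ , v) = blocks-merge J K π σ (to (refines⇔blocks J π) (wJ , J≤))
                         (to (refines⇔blocks K σ) (wK , K≤)) (trans lJ (sym lK))
        v′ = subst (λ L″ → BlockShuffle J K L″ π σ τ) (trans (sym (shuffle-sum v)) J+K≡L) v
    in τ , (shuffle-interleaving v′ , shuffle-blocks v′) , v′

lemma2p8 : (π σ A : List ℕ) → IsPerm π → IsPerm σ → Disjoint π σ
    → Linked _<_ A → All (λ a → (0 < a) × (a < length π + length σ)) A
    → ∃[ N ] (HasSize (λ τ → InS π σ τ × (∀ i → i ∈ Des τ → i ∈ A)) N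
      × HasSize (PairCond π σ (Comp (length π + length σ) A)) N)
lemma2p8 π σ A pπ pσ d linked bounds =
  _ , HasSize-resp shuffle-side counted
    , HasSize-transfer (block-shuffle-correspondence compA d) counted
  where
  compA : List ℕ
  compA = Comp (length π + length σ) A
  counted : HasSize (λ τ → Interleaving π σ τ × Blocks compA τ)
                    (length (filter (blocks? compA) (interleavings π σ)))
  counted = blocked-interleavings-size compA d
  shuffle-side : ∀ τ → (Interleaving π σ τ × Blocks compA τ)
                   ⇔ (InS π σ τ × (∀ i → i ∈ Des τ → i ∈ A))
  shuffle-side τ = mk⇔
    (λ (i , b) → from (InS⇔Interleaving pπ pσ d) i , from (descents-in-A i) b)
    (λ (s , D⊆A) → let i = to (InS⇔Interleaving pπ pσ d) s in i , to (descents-in-A i) D⊆A)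
    where
    descents-in-A : Interleaving π σ τ → (∀ i → i ∈ Des τ → i ∈ A) ⇔ Blocks compA τ
    descents-in-A i = desSubset⇔blocks τ A _ (sym (interleaving-length i)) linked bounds
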